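{- Let $n\ge1$ and $k$ be integers with $n/2-1<k\le n$, $G=\mathbb Z_2^n$, $q=2^n$. Then \[ \lambda^\pm(B_k)\le\frac{2k+2}{q(2k+2-n)},\qquad \lambda^\pm(A_k)\ge 1-\frac{n}{2k+2}. \]
   Context: Elements of $G=\mathbb Z_2^n$ are $0$-$1$ sequences of length $n$; the norm $\|x\|$ is the number of coordinates of $x$ equal to $1$. The ball is $B_k=\{x\in G:\|x\|\le k\}$ and the antiball is $A_k=\{x\in G:\|x\|>k\}\cup\{0\}$. A character of $G$ is a homomorphism $\gamma:G\to\{z\in\mathbb C:|z|=1\}$; $\hat G$ is the group of characters and $\mathbf 1$ the principal character. For $f:G\to\mathbb R$, $\hat f(\gamma)=\sum_{x\in G}\gamma(x)f(x)$. For a set $A\subset G$ with $A=-A$, $0\in A$, let $\mathcal S^\pm(A)$ be the set of $f:G\to\mathbb R$, not identically zero, with $f\le0$ on $G\setminus A$ and $f\ge0$ on $A$, and $\lambda^\pm(A)=\min\{f(0)/\hat f(\mathbf 1): f\in\mathcal S^\pm(A),\ \hat f(\gamma)\ge0\ \forall\gamma\in\hat G\}$.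
   Formalization: The functions f take values in ℚ instead of ℝ. -}

module Defs where

open import Data.Bool using (Bool; true; false; _xor_)
open import Data.Nat as ℕ using (ℕ; zero; suc)
open import Data.Vec using (Vec; []; _∷_; zipWith; replicate)
open import Data.List using (List; []; _∷_; map; _++_; foldr)
open import Data.Rational using (ℚ; 0ℚ; 1ℚ; -_; _+_; _*_; _≤_; _<_; _/_)
open import Data.Integer using (+_)
open import Data.Sum using (_⊎_)
open import Data.Product using (_×_; Σ)
open import Relation.Binary.PropositionalEquality using (_≡_)
open import Relation.Nullary using (¬_)

G : ℕ → Set
G n = Vec Bool n

_⊕_ : ∀ {n} → G n → G n → G n
_⊕_ = zipWith _xor_

𝟘 : ∀ n → G n
𝟘 n = replicate n false

allG : (n : ℕ) → List (G n)
allG zero = [] ∷ []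
allG (suc n) = map (false ∷_) (allG n) ++ map (true ∷_) (allG n)

ΣG : (n : ℕ) → (G n → ℚ) → ℚ
ΣG n f = foldr (λ x acc → f x + acc) 0ℚ (allG n)

‖_‖ : ∀ {n} → G n → ℕ
‖ [] ‖ = 0
‖ false ∷ x ‖ = ‖ x ‖
‖ true ∷ x ‖ = suc ‖ x ‖

InB : ∀ {n} → ℕ → G n → Set
InB k x = ‖ x ‖ ℕ.≤ k

InA : ∀ {n} → ℕ → G n → Set
InA {n} k x = (k ℕ.< ‖ x ‖) ⊎ (x ≡ 𝟘 n)

-- characters of Z_2^n: homomorphisms into the unit circle.  Since every
-- element of G has order ≤ 2, every character takes values in {1,-1} ⊂ ℚ.
record Character (n : ℕ) : Set where
  field
    γ     : G n → ℚ
    unit  : ∀ x → (γ x ≡ 1ℚ) ⊎ (γ x ≡ - 1ℚ)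
    hom   : ∀ x y → γ (x ⊕ y) ≡ γ x * γ y
open Character public

principal : ∀ n → Character n → Set
principal n χ = ∀ x → γ χ x ≡ 1ℚ

fhat : ∀ n → (G n → ℚ) → Character n → ℚ
fhat n f χ = ΣG n (λ x → γ χ x * f x)

fhat1 : ∀ n → (G n → ℚ) → ℚ
fhat1 n f = ΣG n f

Admissible : ∀ n → (G n → Set) → (G n → ℚ) → Set
Admissible n A f =
    (¬ (∀ x → f x ≡ 0ℚ))
  × (∀ x → ¬ A x → f x ≤ 0ℚ)
  × (∀ x → A x → 0ℚ ≤ f x)
  × (∀ (χ : Character n) → 0ℚ ≤ fhat n f χ)

qℚ : ℕ → ℚ
qℚ n = + (2 ℕ.^ n) / 1

ℕtoℚ : ℕ → ℚ
ℕtoℚ m = + m / 1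

{-# OPTIONS --safe #-}
-- Put c = 2k+2-n and L(x) = Σᵢ (-1)^{xᵢ} = n - 2‖x‖, the sum of the n
-- coordinate characters.  The function F = c + L equals 2k+2-2‖x‖, so it is
-- nonnegative on B_k and nonpositive off it; its Fourier transform is
-- q·(c·[γ = 1] + [γ is a coordinate character]), hence nonnegative.  Since F(0) = 2k+2 and Σ F = q c, F witnesses the bound for
-- B_k.  Dually, if f is admissible for A_k then f·F ≤ 0 away from 0, so
-- f(0)(2k+2) ≥ Σ f F = c Σ f + Σᵢ f̂(eᵢ) ≥ c f̂(1).
module Submission where

open import Defs
open import Data.Nat using (ℕ; _≤_; _<_; _+_; _*_; _∸_)
open import Data.Rational using (ℚ; 0ℚ) renaming (_≤_ to _≤ℚ_; _<_ to _<ℚ_; _*_ to _*ℚ_)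
open import Data.Product using (_×_; Σ)

open import Data.Bool using (Bool; true; false; _xor_)
open import Data.Integer as ℤ using (+_)
import Data.Integer.Properties as ℤP
open import Data.List using (List; []; _∷_; _++_; map; foldr)
open import Data.Nat as ℕ using (zero; suc; z≤n; s≤s)
import Data.Nat.Coprimality as Coprime
import Data.Nat.Properties as ℕP
open import Data.Product using (_,_)
open import Data.Rational as ℚ using (1ℚ; -_; mkℚ) renaming (_+_ to _+ℚ_)
import Data.Rational.Properties as ℚP
open import Data.Rational.Solver using (module +-*-Solver)
open import Data.Sum using (_⊎_; inj₁; inj₂)
open import Data.Vec using ([]; _∷_)
open import Relation.Binary.PropositionalEquality
open import Relation.Nullary using (¬_; yes; no)

open +-*-Solver

ℕtoℚ≡mkℚ : ∀ m → ℕtoℚ m ≡ mkℚ (+ m) 0 (Coprime.sym (Coprime.1-coprimeTo m))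
ℕtoℚ≡mkℚ m = ℚP.normalize-coprime (Coprime.sym (Coprime.1-coprimeTo m))

ℕtoℚ-+ : ∀ a b → ℕtoℚ (a + b) ≡ ℕtoℚ a +ℚ ℕtoℚ b
ℕtoℚ-+ a b = sym (begin
  ℕtoℚ a +ℚ ℕtoℚ b
    ≡⟨ cong₂ _+ℚ_ (ℕtoℚ≡mkℚ a) (ℕtoℚ≡mkℚ b) ⟩
  (+ a ℤ.* + 1 ℤ.+ + b ℤ.* + 1) ℚ./ 1
    ≡⟨ cong (ℚ._/ 1) (cong₂ ℤ._+_ (ℤP.*-identityʳ (+ a)) (ℤP.*-identityʳ (+ b))) ⟩
  (+ a ℤ.+ + b) ℚ./ 1
    ≡⟨ cong (ℚ._/ 1) (sym (ℤP.pos-+ a b)) ⟩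
  ℕtoℚ (a + b) ∎)
  where open ≡-Reasoning

ℕtoℚ-mono-≤ : ∀ {a b} → a ≤ b → ℕtoℚ a ≤ℚ ℕtoℚ b
ℕtoℚ-mono-≤ {a} {b} a≤b = subst₂ _≤ℚ_ (sym (ℕtoℚ≡mkℚ a)) (sym (ℕtoℚ≡mkℚ b))
  (ℚ.*≤* (subst₂ ℤ._≤_ (sym (ℤP.*-identityʳ (+ a))) (sym (ℤP.*-identityʳ (+ b))) (ℤ.+≤+ a≤b)))

ℕtoℚ-pos : ∀ {m} → 0 < m → 0ℚ <ℚ ℕtoℚ m
ℕtoℚ-pos {suc m} _ = subst (0ℚ <ℚ_) (sym (ℕtoℚ≡mkℚ (suc m)))
  (ℚ.*<* (subst (ℤ._<_ (+ 0)) (sym (ℤP.*-identityʳ (+ suc m))) (ℤ.+<+ (s≤s z≤n))))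

*-nonNeg : ∀ {a b} → 0ℚ ≤ℚ a → 0ℚ ≤ℚ b → 0ℚ ≤ℚ a *ℚ b
*-nonNeg {a} {b} 0≤a 0≤b =
  ℚP.nonNegative⁻¹ _ {{ℚP.nonNeg*nonNeg⇒nonNeg a {{ℚ.nonNegative 0≤a}} b {{ℚ.nonNegative 0≤b}}}}

*-nonNeg-nonPos : ∀ {a b} → 0ℚ ≤ℚ a → b ≤ℚ 0ℚ → a *ℚ b ≤ℚ 0ℚ
*-nonNeg-nonPos {a} {b} 0≤a b≤0 =
  ℚP.nonPositive⁻¹ _ {{ℚP.nonNeg*nonPos⇒nonPos a {{ℚ.nonNegative 0≤a}} b {{ℚ.nonPositive b≤0}}}}

*-nonPos-nonNeg : ∀ {a b} → a ≤ℚ 0ℚ → 0ℚ ≤ℚ b → a *ℚ b ≤ℚ 0ℚ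
*-nonPos-nonNeg {a} {b} a≤0 0≤b =
  ℚP.nonPositive⁻¹ _ {{ℚP.nonPos*nonNeg⇒nonPos a {{ℚ.nonPositive a≤0}} b {{ℚ.nonNegative 0≤b}}}}

+-cancelʳ-≤ : ∀ c {a b} → a +ℚ c ≤ℚ b +ℚ c → a ≤ℚ b
+-cancelʳ-≤ c {a} {b} le = subst₂ _≤ℚ_ (cancel a) (cancel b) (ℚP.+-monoˡ-≤ (- c) le)
  where
  cancel : ∀ x → (x +ℚ c) +ℚ (- c) ≡ x
  cancel x = solve 2 (λ x c → (x :+ c) :+ (:- c) := x) refl x c

sumℚ : {A : Set} → List A → (A → ℚ) → ℚ
sumℚ xs f = foldr (λ x acc → f x +ℚ acc) 0ℚ xs

module _ {A : Set} where

  sumℚ-++ : ∀ (xs ys : List A) f → sumℚ (xs ++ ys) f ≡ sumℚ xs f +ℚ sumℚ ys f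
  sumℚ-++ [] ys f = sym (ℚP.+-identityˡ _)
  sumℚ-++ (x ∷ xs) ys f = trans (cong (f x +ℚ_) (sumℚ-++ xs ys f)) (sym (ℚP.+-assoc (f x) _ _))

  sumℚ-map : ∀ {B : Set} (h : B → A) xs f → sumℚ (map h xs) f ≡ sumℚ xs (λ x → f (h x))
  sumℚ-map h [] f = refl
  sumℚ-map h (x ∷ xs) f = cong (f (h x) +ℚ_) (sumℚ-map h xs f)

  sumℚ-cong : ∀ (xs : List A) {f g} → (∀ x → f x ≡ g x) → sumℚ xs f ≡ sumℚ xs g
  sumℚ-cong [] f≡g = refl
  sumℚ-cong (x ∷ xs) f≡g = cong₂ _+ℚ_ (f≡g x) (sumℚ-cong xs f≡g)

  sumℚ-+ : ∀ (xs : List A) f g → sumℚ xs (λ x → f x +ℚ g x) ≡ sumℚ xs f +ℚ sumℚ xs g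
  sumℚ-+ [] f g = refl
  sumℚ-+ (x ∷ xs) f g rewrite sumℚ-+ xs f g =
    solve 4 (λ a b c d → (a :+ b) :+ (c :+ d) := (a :+ c) :+ (b :+ d)) refl
      (f x) (g x) (sumℚ xs f) (sumℚ xs g)

  sumℚ-* : ∀ (xs : List A) c f → sumℚ xs (λ x → c *ℚ f x) ≡ c *ℚ sumℚ xs f
  sumℚ-* [] c f = sym (ℚP.*-zeroʳ c)
  sumℚ-* (x ∷ xs) c f rewrite sumℚ-* xs c f = sym (ℚP.*-distribˡ-+ c (f x) _)

  sumℚ-nonPos : ∀ (xs : List A) f → (∀ x → f x ≤ℚ 0ℚ) → sumℚ xs f ≤ℚ 0ℚ
  sumℚ-nonPos [] f f≤0 = ℚP.≤-refl
  sumℚ-nonPos (x ∷ xs) f f≤0 = ℚP.+-mono-≤ (f≤0 x) (sumℚ-nonPos xs f f≤0)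

ΣG-suc : ∀ n f → ΣG (suc n) f ≡ ΣG n (λ x → f (false ∷ x)) +ℚ ΣG n (λ x → f (true ∷ x))
ΣG-suc n f = trans (sumℚ-++ (map (false ∷_) (allG n)) _ f)
  (cong₂ _+ℚ_ (sumℚ-map (false ∷_) (allG n) f) (sumℚ-map (true ∷_) (allG n) f))

ΣG-const : ∀ n c → ΣG n (λ _ → c) ≡ qℚ n *ℚ c
ΣG-const zero c = trans (ℚP.+-identityʳ c) (sym (ℚP.*-identityˡ c))
ΣG-const (suc n) c = begin
  ΣG (suc n) (λ _ → c)              ≡⟨ ΣG-suc n (λ _ → c) ⟩
  ΣG n (λ _ → c) +ℚ ΣG n (λ _ → c)  ≡⟨ cong₂ _+ℚ_ (ΣG-const n c) (ΣG-const n c) ⟩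
  qℚ n *ℚ c +ℚ qℚ n *ℚ c            ≡⟨ ℚP.*-distribʳ-+ c (qℚ n) (qℚ n) ⟨
  (qℚ n +ℚ qℚ n) *ℚ c               ≡⟨ cong (_*ℚ c) (ℕtoℚ-+ (2 ℕ.^ n) (2 ℕ.^ n)) ⟨
  ℕtoℚ (2 ℕ.^ n + 2 ℕ.^ n) *ℚ c     ≡⟨ cong (λ m → ℕtoℚ (2 ℕ.^ n + m) *ℚ c) (ℕP.+-identityʳ (2 ℕ.^ n)) ⟨
  qℚ (suc n) *ℚ c                   ∎
  where open ≡-Reasoning

ΣG≤at𝟘 : ∀ n h → (∀ x → 0 < ‖ x ‖ → h x ≤ℚ 0ℚ) → ΣG n h ≤ℚ h (𝟘 n)
ΣG≤at𝟘 zero h _ = ℚP.≤-reflexive (ℚP.+-identityʳ (h []))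
ΣG≤at𝟘 (suc n) h h≤0 = begin
  ΣG (suc n) h                                              ≡⟨ ΣG-suc n h ⟩
  ΣG n (λ x → h (false ∷ x)) +ℚ ΣG n (λ x → h (true ∷ x))  ≤⟨ ℚP.+-mono-≤ below-𝟘 true-half≤0 ⟩
  h (𝟘 (suc n)) +ℚ 0ℚ                                       ≡⟨ ℚP.+-identityʳ _ ⟩
  h (𝟘 (suc n))                                             ∎
  where
  open ℚP.≤-Reasoning
  below-𝟘 = ΣG≤at𝟘 n (λ x → h (false ∷ x)) (λ x → h≤0 (false ∷ x))
  true-half≤0 = sumℚ-nonPos (allG n) (λ x → h (true ∷ x)) (λ x → h≤0 (true ∷ x) (s≤s z≤n))

‖𝟘‖≡0 : ∀ n → ‖ 𝟘 n ‖ ≡ 0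
‖𝟘‖≡0 zero = refl
‖𝟘‖≡0 (suc n) = ‖𝟘‖≡0 n

±1 : ℚ → Set
±1 a = (a ≡ 1ℚ) ⊎ (a ≡ - 1ℚ)

±1-* : ∀ {a b} → ±1 a → ±1 b → ±1 (a *ℚ b)
±1-* (inj₁ refl) (inj₁ refl) = inj₁ refl
±1-* (inj₁ refl) (inj₂ refl) = inj₂ refl
±1-* (inj₂ refl) (inj₁ refl) = inj₂ refl
±1-* (inj₂ refl) (inj₂ refl) = inj₁ refl

_·χ_ : ∀ {n} → Character n → Character n → Character n
χ ·χ ψ = record
  { γ    = λ x → γ χ x *ℚ γ ψ x
  ; unit = λ x → ±1-* (unit χ x) (unit ψ x)
  ; hom  = λ x y → trans (cong₂ _*ℚ_ (hom χ x y) (hom ψ x y))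
             (solve 4 (λ a b c d → (a :* b) :* (c :* d) := (a :* c) :* (b :* d)) refl
               (γ χ x) (γ χ y) (γ ψ x) (γ ψ y))
  }

restrictχ : ∀ {n} → Character (suc n) → Character n
restrictχ χ = record
  { γ    = λ x → γ χ (false ∷ x)
  ; unit = λ x → unit χ (false ∷ x)
  ; hom  = λ x y → hom χ (false ∷ x) (false ∷ y)
  }

liftχ : ∀ {n} → Character n → Character (suc n)
liftχ χ = record
  { γ    = λ { (_ ∷ x) → γ χ x }
  ; unit = λ { (_ ∷ x) → unit χ x }
  ; hom  = λ { (_ ∷ x) (_ ∷ y) → hom χ x y }
  }

sign : Bool → ℚ
sign false = 1ℚ
sign true  = - 1ℚ

sign-±1 : ∀ b → ±1 (sign b)
sign-±1 false = inj₁ refl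
sign-±1 true  = inj₂ refl

sign-xor : ∀ b c → sign (b xor c) ≡ sign b *ℚ sign c
sign-xor false false = refl
sign-xor false true  = refl
sign-xor true  false = refl
sign-xor true  true  = refl

headχ : ∀ n → Character (suc n)
headχ n = record
  { γ    = λ { (b ∷ _) → sign b }
  ; unit = λ { (b ∷ _) → sign-±1 b }
  ; hom  = λ { (b ∷ _) (c ∷ _) → sign-xor b c }
  }

𝟘⊕ : ∀ n (x : G n) → 𝟘 n ⊕ x ≡ x
𝟘⊕ zero [] = refl
𝟘⊕ (suc n) (b ∷ x) = cong (b ∷_) (𝟘⊕ n x)

γ-true∷ : ∀ {n} (χ : Character (suc n)) x → γ χ (true ∷ x) ≡ γ χ (true ∷ 𝟘 n) *ℚ γ χ (false ∷ x)
γ-true∷ {n} χ x = trans (cong (λ y → γ χ (true ∷ y)) (sym (𝟘⊕ n x))) (hom χ (true ∷ 𝟘 n) (false ∷ x))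

+±1*-nonNeg : ∀ {s u} → 0ℚ ≤ℚ s → ±1 u → 0ℚ ≤ℚ s +ℚ u *ℚ s
+±1*-nonNeg {s} 0≤s (inj₁ refl) = ℚP.+-mono-≤ 0≤s (subst (0ℚ ≤ℚ_) (sym (ℚP.*-identityˡ s)) 0≤s)
+±1*-nonNeg {s} 0≤s (inj₂ refl) =
  ℚP.≤-reflexive (sym (solve 1 (λ s → s :+ con (- 1ℚ) :* s := con 0ℚ) refl s))

-- Σ γ is q or 0; inductively, the second half of G contributes ±(the first half).
ΣG-character-nonNeg : ∀ n (χ : Character n) → 0ℚ ≤ℚ ΣG n (γ χ)
ΣG-character-nonNeg zero χ with unit χ [] | hom χ [] []
... | inj₁ γ[]≡1 | _ = subst (0ℚ ≤ℚ_) (sym (trans (ℚP.+-identityʳ _) γ[]≡1)) (ℚP.nonNegative⁻¹ 1ℚ)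
... | inj₂ γ[]≡-1 | γ[]≡γ[]² with trans (sym γ[]≡-1) (trans γ[]≡γ[]² (cong₂ _*ℚ_ γ[]≡-1 γ[]≡-1))
... | ()
ΣG-character-nonNeg (suc n) χ =
  subst (0ℚ ≤ℚ_) (sym halves) (+±1*-nonNeg (ΣG-character-nonNeg n (restrictχ χ)) (unit χ (true ∷ 𝟘 n)))
  where
  u = γ χ (true ∷ 𝟘 n)
  halves : ΣG (suc n) (γ χ) ≡ ΣG n (γ (restrictχ χ)) +ℚ u *ℚ ΣG n (γ (restrictχ χ))
  halves = trans (ΣG-suc n (γ χ))
    (cong (ΣG n (γ (restrictχ χ)) +ℚ_) (trans (sumℚ-cong (allG n) (γ-true∷ χ)) (sumℚ-* (allG n) u _)))

fhat-character-nonNeg : ∀ n (χ ψ : Character n) → 0ℚ ≤ℚ fhat n (γ χ) ψ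
fhat-character-nonNeg n χ ψ = ΣG-character-nonNeg n (ψ ·χ χ)

coordinateSum : ∀ {n} → G n → ℚ
coordinateSum []      = 0ℚ
coordinateSum (b ∷ x) = sign b +ℚ coordinateSum x

coordinateSum+2‖‖ : ∀ {n} (x : G n) → coordinateSum x +ℚ ℕtoℚ (2 * ‖ x ‖) ≡ ℕtoℚ n
coordinateSum+2‖‖ [] = ℚP.+-identityˡ _
coordinateSum+2‖‖ {suc n} (false ∷ x) = begin
  (1ℚ +ℚ coordinateSum x) +ℚ ℕtoℚ (2 * ‖ x ‖)  ≡⟨ ℚP.+-assoc 1ℚ (coordinateSum x) _ ⟩
  1ℚ +ℚ (coordinateSum x +ℚ ℕtoℚ (2 * ‖ x ‖))  ≡⟨ cong (1ℚ +ℚ_) (coordinateSum+2‖‖ x) ⟩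
  1ℚ +ℚ ℕtoℚ n                                  ≡⟨ ℕtoℚ-+ 1 n ⟨
  ℕtoℚ (suc n)                                  ∎
  where open ≡-Reasoning
coordinateSum+2‖‖ {suc n} (true ∷ x) = begin
  (- 1ℚ +ℚ coordinateSum x) +ℚ ℕtoℚ (2 * suc ‖ x ‖)
    ≡⟨ cong (λ m → (- 1ℚ +ℚ coordinateSum x) +ℚ ℕtoℚ m) (ℕP.*-suc 2 ‖ x ‖) ⟩
  (- 1ℚ +ℚ coordinateSum x) +ℚ ℕtoℚ (2 + 2 * ‖ x ‖)
    ≡⟨ cong ((- 1ℚ +ℚ coordinateSum x) +ℚ_) (ℕtoℚ-+ 2 (2 * ‖ x ‖)) ⟩
  (- 1ℚ +ℚ coordinateSum x) +ℚ (ℕtoℚ 2 +ℚ ℕtoℚ (2 * ‖ x ‖))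
    ≡⟨ solve 2 (λ l m → (con (- 1ℚ) :+ l) :+ (con (ℕtoℚ 2) :+ m) := con 1ℚ :+ (l :+ m)) refl
         (coordinateSum x) (ℕtoℚ (2 * ‖ x ‖)) ⟩
  1ℚ +ℚ (coordinateSum x +ℚ ℕtoℚ (2 * ‖ x ‖))
    ≡⟨ cong (1ℚ +ℚ_) (coordinateSum+2‖‖ x) ⟩
  1ℚ +ℚ ℕtoℚ n
    ≡⟨ ℕtoℚ-+ 1 n ⟨
  ℕtoℚ (suc n) ∎
  where open ≡-Reasoning

coordinateSum-𝟘 : ∀ n → coordinateSum (𝟘 n) ≡ ℕtoℚ n
coordinateSum-𝟘 zero    = refl
coordinateSum-𝟘 (suc n) = trans (cong (1ℚ +ℚ_) (coordinateSum-𝟘 n)) (sym (ℕtoℚ-+ 1 n))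

ΣG-coordinateSum : ∀ n → ΣG n coordinateSum ≡ 0ℚ
ΣG-coordinateSum zero    = refl
ΣG-coordinateSum (suc n) = begin
  ΣG (suc n) coordinateSum
    ≡⟨ ΣG-suc n coordinateSum ⟩
  ΣG n (λ x → 1ℚ +ℚ coordinateSum x) +ℚ ΣG n (λ x → - 1ℚ +ℚ coordinateSum x)
    ≡⟨ sumℚ-+ (allG n) (λ x → 1ℚ +ℚ coordinateSum x) (λ x → - 1ℚ +ℚ coordinateSum x) ⟨
  ΣG n (λ x → (1ℚ +ℚ coordinateSum x) +ℚ (- 1ℚ +ℚ coordinateSum x))
    ≡⟨ sumℚ-cong (allG n) (λ x → solve 1 (λ l → (con 1ℚ :+ l) :+ (con (- 1ℚ) :+ l) := l :+ l) refl
         (coordinateSum x)) ⟩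
  ΣG n (λ x → coordinateSum x +ℚ coordinateSum x)
    ≡⟨ sumℚ-+ (allG n) coordinateSum coordinateSum ⟩
  ΣG n coordinateSum +ℚ ΣG n coordinateSum
    ≡⟨ cong₂ _+ℚ_ (ΣG-coordinateSum n) (ΣG-coordinateSum n) ⟩
  0ℚ ∎
  where open ≡-Reasoning

foldHead : ∀ {n} → (G (suc n) → ℚ) → G n → ℚ
foldHead f y = f (false ∷ y) +ℚ f (true ∷ y)

fhat-foldHead : ∀ n f (χ : Character n) → fhat n (foldHead f) χ ≡ fhat (suc n) f (liftχ χ)
fhat-foldHead n f χ = begin
  ΣG n (λ y → γ χ y *ℚ (f (false ∷ y) +ℚ f (true ∷ y)))
    ≡⟨ sumℚ-cong (allG n) (λ y → ℚP.*-distribˡ-+ (γ χ y) (f (false ∷ y)) (f (true ∷ y))) ⟩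
  ΣG n (λ y → γ χ y *ℚ f (false ∷ y) +ℚ γ χ y *ℚ f (true ∷ y))
    ≡⟨ sumℚ-+ (allG n) (λ y → γ χ y *ℚ f (false ∷ y)) (λ y → γ χ y *ℚ f (true ∷ y)) ⟩
  ΣG n (λ y → γ χ y *ℚ f (false ∷ y)) +ℚ ΣG n (λ y → γ χ y *ℚ f (true ∷ y))
    ≡⟨ ΣG-suc n (λ x → γ (liftχ χ) x *ℚ f x) ⟨
  fhat (suc n) f (liftχ χ) ∎
  where open ≡-Reasoning

ΣG-*coordinateSum-suc : ∀ n f →
  ΣG (suc n) (λ x → f x *ℚ coordinateSum x)
    ≡ fhat (suc n) f (headχ n) +ℚ ΣG n (λ y → foldHead f y *ℚ coordinateSum y)
ΣG-*coordinateSum-suc n f = begin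
  ΣG (suc n) (λ x → f x *ℚ coordinateSum x)
    ≡⟨ ΣG-suc n (λ x → f x *ℚ coordinateSum x) ⟩
  ΣG n (λ y → a y *ℚ (1ℚ +ℚ l y)) +ℚ ΣG n (λ y → b y *ℚ (- 1ℚ +ℚ l y))
    ≡⟨ sumℚ-+ (allG n) (λ y → a y *ℚ (1ℚ +ℚ l y)) (λ y → b y *ℚ (- 1ℚ +ℚ l y)) ⟨
  ΣG n (λ y → a y *ℚ (1ℚ +ℚ l y) +ℚ b y *ℚ (- 1ℚ +ℚ l y))
    ≡⟨ sumℚ-cong (allG n) (λ y → regroup (a y) (b y) (l y)) ⟩
  ΣG n (λ y → headTerm y +ℚ foldHead f y *ℚ l y)
    ≡⟨ sumℚ-+ (allG n) headTerm (λ y → foldHead f y *ℚ l y) ⟩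
  ΣG n headTerm +ℚ ΣG n (λ y → foldHead f y *ℚ l y)
    ≡⟨ cong (_+ℚ ΣG n (λ y → foldHead f y *ℚ l y))
         (trans (sumℚ-+ (allG n) (λ y → 1ℚ *ℚ a y) (λ y → - 1ℚ *ℚ b y))
                (sym (ΣG-suc n (λ x → γ (headχ n) x *ℚ f x)))) ⟩
  fhat (suc n) f (headχ n) +ℚ ΣG n (λ y → foldHead f y *ℚ l y) ∎
  where
  open ≡-Reasoning
  a b l : G n → ℚ
  a y = f (false ∷ y)
  b y = f (true ∷ y)
  l   = coordinateSum
  headTerm : G n → ℚ
  headTerm y = 1ℚ *ℚ a y +ℚ - 1ℚ *ℚ b y
  regroup : ∀ a b l → a *ℚ (1ℚ +ℚ l) +ℚ b *ℚ (- 1ℚ +ℚ l) ≡ (1ℚ *ℚ a +ℚ - 1ℚ *ℚ b) +ℚ (a +ℚ b) *ℚ l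
  regroup = solve 3 (λ a b l → a :* (con 1ℚ :+ l) :+ b :* (con (- 1ℚ) :+ l)
                             := (con 1ℚ :* a :+ con (- 1ℚ) :* b) :+ (a :+ b) :* l) refl

-- Σ f L = Σᵢ f̂(eᵢ) for the coordinate characters eᵢ.
ΣG-*coordinateSum-nonNeg : ∀ n f → (∀ χ → 0ℚ ≤ℚ fhat n f χ) →
  0ℚ ≤ℚ ΣG n (λ x → f x *ℚ coordinateSum x)
ΣG-*coordinateSum-nonNeg zero f _ =
  ℚP.≤-reflexive (sym (trans (ℚP.+-identityʳ (f [] *ℚ 0ℚ)) (ℚP.*-zeroʳ (f []))))
ΣG-*coordinateSum-nonNeg (suc n) f f̂≥0 = subst (0ℚ ≤ℚ_) (sym (ΣG-*coordinateSum-suc n f))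
  (ℚP.+-mono-≤ (f̂≥0 (headχ n))
    (ΣG-*coordinateSum-nonNeg n (foldHead f) (λ χ → subst (0ℚ ≤ℚ_) (sym (fhat-foldHead n f χ)) (f̂≥0 (liftχ χ)))))

module BallFunction (n k : ℕ) (n<2k+2 : n < 2 * k + 2) where

  c K : ℚ
  c = ℕtoℚ (2 * k + 2 ∸ n)
  K = ℕtoℚ (2 * k + 2)

  F : G n → ℚ
  F x = c +ℚ coordinateSum x

  c+n≡K : c +ℚ ℕtoℚ n ≡ K
  c+n≡K = trans (sym (ℕtoℚ-+ (2 * k + 2 ∸ n) n)) (cong ℕtoℚ (ℕP.m∸n+n≡m (ℕP.<⇒≤ n<2k+2)))

  F+2‖‖ : ∀ x → F x +ℚ ℕtoℚ (2 * ‖ x ‖) ≡ K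
  F+2‖‖ x = trans (ℚP.+-assoc c (coordinateSum x) _) (trans (cong (c +ℚ_) (coordinateSum+2‖‖ x)) c+n≡K)

  F-𝟘 : F (𝟘 n) ≡ K
  F-𝟘 = trans (cong (c +ℚ_) (coordinateSum-𝟘 n)) c+n≡K

  c-pos : 0ℚ <ℚ c
  c-pos = ℕtoℚ-pos (ℕP.m<n⇒0<n∸m n<2k+2)

  K-pos : 0ℚ <ℚ K
  K-pos = ℕtoℚ-pos (ℕP.≤-trans (s≤s z≤n) (ℕP.m≤n+m 2 (2 * k)))

  F-nonNeg : ∀ x → InB k x → 0ℚ ≤ℚ F x
  F-nonNeg x ‖x‖≤k = +-cancelʳ-≤ (ℕtoℚ (2 * ‖ x ‖))
    (subst₂ _≤ℚ_ (sym (ℚP.+-identityˡ _)) (sym (F+2‖‖ x)) (ℕtoℚ-mono-≤ 2‖x‖≤2k+2))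
    where
    2‖x‖≤2k+2 : 2 * ‖ x ‖ ≤ 2 * k + 2
    2‖x‖≤2k+2 = ℕP.≤-trans (ℕP.*-monoʳ-≤ 2 ‖x‖≤k) (ℕP.m≤m+n (2 * k) 2)

  F-nonPos : ∀ x → k < ‖ x ‖ → F x ≤ℚ 0ℚ
  F-nonPos x k<‖x‖ = +-cancelʳ-≤ (ℕtoℚ (2 * ‖ x ‖))
    (subst₂ _≤ℚ_ (sym (F+2‖‖ x)) (sym (ℚP.+-identityˡ _)) (ℕtoℚ-mono-≤ 2k+2≤2‖x‖))
    where
    2k+2≤2‖x‖ : 2 * k + 2 ≤ 2 * ‖ x ‖
    2k+2≤2‖x‖ = subst (_≤ 2 * ‖ x ‖) (trans (ℕP.*-suc 2 k) (ℕP.+-comm 2 (2 * k))) (ℕP.*-monoʳ-≤ 2 k<‖x‖)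

  fhat-F : ∀ χ → fhat n F χ ≡ c *ℚ ΣG n (γ χ) +ℚ ΣG n (λ x → γ χ x *ℚ coordinateSum x)
  fhat-F χ = begin
    ΣG n (λ x → γ χ x *ℚ (c +ℚ coordinateSum x))
      ≡⟨ sumℚ-cong (allG n) (λ x → solve 3 (λ g c l → g :* (c :+ l) := c :* g :+ g :* l) refl
           (γ χ x) c (coordinateSum x)) ⟩
    ΣG n (λ x → c *ℚ γ χ x +ℚ γ χ x *ℚ coordinateSum x)
      ≡⟨ sumℚ-+ (allG n) (λ x → c *ℚ γ χ x) (λ x → γ χ x *ℚ coordinateSum x) ⟩
    ΣG n (λ x → c *ℚ γ χ x) +ℚ ΣG n (λ x → γ χ x *ℚ coordinateSum x)
      ≡⟨ cong (_+ℚ ΣG n (λ x → γ χ x *ℚ coordinateSum x)) (sumℚ-* (allG n) c (γ χ)) ⟩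
    c *ℚ ΣG n (γ χ) +ℚ ΣG n (λ x → γ χ x *ℚ coordinateSum x) ∎
    where open ≡-Reasoning

  fhat-F-nonNeg : ∀ χ → 0ℚ ≤ℚ fhat n F χ
  fhat-F-nonNeg χ = subst (0ℚ ≤ℚ_) (sym (fhat-F χ))
    (ℚP.+-mono-≤ (*-nonNeg (ℚP.<⇒≤ c-pos) (ΣG-character-nonNeg n χ))
                 (ΣG-*coordinateSum-nonNeg n (γ χ) (fhat-character-nonNeg n χ)))

  ΣG-F : ΣG n F ≡ qℚ n *ℚ c
  ΣG-F = trans (sumℚ-+ (allG n) (λ _ → c) coordinateSum)
    (trans (cong₂ _+ℚ_ (ΣG-const n c) (ΣG-coordinateSum n)) (ℚP.+-identityʳ _))

  ΣG-F-pos : 0ℚ <ℚ ΣG n F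
  ΣG-F-pos = subst (0ℚ <ℚ_) (sym ΣG-F)
    (ℚP.positive⁻¹ _ {{ℚP.pos*pos⇒pos (qℚ n) {{ℚ.positive (ℕtoℚ-pos (ℕP.m^n>0 2 n))}} c {{ℚ.positive c-pos}}}})

  F-admissible : Admissible n (InB k) F
  F-admissible = F≢0 , (λ x x∉B → F-nonPos x (ℕP.≰⇒> x∉B)) , F-nonNeg , fhat-F-nonNeg
    where
    F≢0 : ¬ (∀ x → F x ≡ 0ℚ)
    F≢0 F≡0 = ℚP.<⇒≢ K-pos (sym (trans (sym F-𝟘) (F≡0 (𝟘 n))))

  ball-bound : Σ (G n → ℚ) λ f → Admissible n (InB k) f × (0ℚ <ℚ fhat1 n f)
    × (f (𝟘 n) *ℚ (qℚ n *ℚ c) ≤ℚ K *ℚ fhat1 n f)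
  ball-bound = F , F-admissible , ΣG-F-pos , ℚP.≤-reflexive (cong₂ _*ℚ_ F-𝟘 (sym ΣG-F))

  *F-nonPos-off-𝟘 : ∀ f → Admissible n (InA k) f → ∀ x → 0 < ‖ x ‖ → f x *ℚ F x ≤ℚ 0ℚ
  *F-nonPos-off-𝟘 f (_ , f≤0 , 0≤f , _) x 0<‖x‖ with k ℕ.<? ‖ x ‖
  ... | yes k<‖x‖ = *-nonNeg-nonPos (0≤f x (inj₁ k<‖x‖)) (F-nonPos x k<‖x‖)
  ... | no  k≮‖x‖ = *-nonPos-nonNeg (f≤0 x x∉A) (F-nonNeg x (ℕP.≮⇒≥ k≮‖x‖))
    where
    x∉A : ¬ InA k x
    x∉A (inj₁ k<‖x‖) = k≮‖x‖ k<‖x‖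
    x∉A (inj₂ x≡𝟘)   = ℕP.<-irrefl (sym (trans (cong ‖_‖ x≡𝟘) (‖𝟘‖≡0 n))) 0<‖x‖

  ΣG-*F : ∀ f → ΣG n (λ x → f x *ℚ F x) ≡ c *ℚ fhat1 n f +ℚ ΣG n (λ x → f x *ℚ coordinateSum x)
  ΣG-*F f = begin
    ΣG n (λ x → f x *ℚ (c +ℚ coordinateSum x))
      ≡⟨ sumℚ-cong (allG n) (λ x → ℚP.*-distribˡ-+ (f x) c (coordinateSum x)) ⟩
    ΣG n (λ x → f x *ℚ c +ℚ f x *ℚ coordinateSum x)
      ≡⟨ sumℚ-+ (allG n) (λ x → f x *ℚ c) (λ x → f x *ℚ coordinateSum x) ⟩
    ΣG n (λ x → f x *ℚ c) +ℚ ΣG n (λ x → f x *ℚ coordinateSum x)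
      ≡⟨ cong (_+ℚ ΣG n (λ x → f x *ℚ coordinateSum x))
           (trans (sumℚ-cong (allG n) (λ x → ℚP.*-comm (f x) c)) (sumℚ-* (allG n) c f)) ⟩
    c *ℚ ΣG n f +ℚ ΣG n (λ x → f x *ℚ coordinateSum x) ∎
    where open ≡-Reasoning

  antiball-bound : ∀ f → Admissible n (InA k) f → c *ℚ fhat1 n f ≤ℚ f (𝟘 n) *ℚ K
  antiball-bound f f-adm@(_ , _ , _ , f̂≥0) = begin
    c *ℚ S           ≡⟨ ℚP.+-identityʳ _ ⟨
    c *ℚ S +ℚ 0ℚ     ≤⟨ ℚP.+-monoʳ-≤ (c *ℚ S) (ΣG-*coordinateSum-nonNeg n f f̂≥0) ⟩
    c *ℚ S +ℚ ΣG n (λ x → f x *ℚ coordinateSum x)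
                     ≡⟨ ΣG-*F f ⟨
    ΣG n (λ x → f x *ℚ F x)
                     ≤⟨ ΣG≤at𝟘 n (λ x → f x *ℚ F x) (*F-nonPos-off-𝟘 f f-adm) ⟩
    f (𝟘 n) *ℚ F (𝟘 n) ≡⟨ cong (f (𝟘 n) *ℚ_) F-𝟘 ⟩
    f (𝟘 n) *ℚ K     ∎
    where
    open ℚP.≤-Reasoning
    S = fhat1 n f

theorem10p3 : (n k : ℕ) → 1 ≤ n → n < 2 * k + 2 → k ≤ n →
    -- λ^±(B_k) ≤ (2k+2) / (q (2k+2-n)) : some admissible f attains ratio ≤ the bound
    (Σ (G n → ℚ) λ f → Admissible n (InB k) f × (0ℚ <ℚ fhat1 n f)
        × ((f (𝟘 n) *ℚ (qℚ n *ℚ ℕtoℚ (2 * k + 2 ∸ n))) ≤ℚ (ℕtoℚ (2 * k + 2) *ℚ fhat1 n f)))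
    ×
    -- λ^±(A_k) ≥ 1 - n/(2k+2) = (2k+2-n)/(2k+2) : every admissible f has ratio ≥ the bound
    ((f : G n → ℚ) → Admissible n (InA k) f → 0ℚ <ℚ fhat1 n f →
        (ℕtoℚ (2 * k + 2 ∸ n) *ℚ fhat1 n f) ≤ℚ (f (𝟘 n) *ℚ ℕtoℚ (2 * k + 2)))
theorem10p3 n k _ n<2k+2 _ = ball-bound , λ f f-adm _ → antiball-bound f f-adm
  where open BallFunction n k n<2k+2
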